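{- $\mathbb{T}$ proves that every set has a transitive closure: for each $x$ there is a transitive set $y$ with $x\subseteq y$ such that $y\subseteq z$ for every transitive $z$ with $x\subseteq z$. Furthermore, the class function $x\mapsto\mathrm{TC}(x)$ is definable.
   Context: $\mathbb{T}$ is the intuitionistic set theory (language $\{\in\}$) with axioms Extensionality, Pairing, Union, Binary Intersection, the Set Induction scheme for all formulas, and $V=\mathrm{Fin}$ (every set is in bijection with some von Neumann natural number $n\in\omega$, $\omega$ being the class of ordinals $\alpha$ each element of $\alpha\cup\{\alpha\}$ being $\varnothing$ or a successor ordinal $\gamma\cup\{\gamma\}$). -}

module Defs where

open import Data.Nat using (ℕ; zero; suc)
open import Data.Fin using (Fin; zero; suc)
open import Data.List using (List; []; _∷_; map)
open import Data.List.Membership.Propositional using (_∈_)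
open import Data.List.Relation.Unary.All using (All)
open import Data.Product using (Σ; _×_)

infix  7 _∈̇_ _≐_
infixr 6 _∧̇_
infixr 5 _∨̇_
infixr 4 _⇒_ _⇔_

-- Formulas with n free variables (scoped de Bruijn indices; variable 0 is the
-- innermost bound one).  The language has no function symbols, so terms are
-- variables.
data Fm (n : ℕ) : Set where
  _∈̇_ _≐_    : Fin n → Fin n → Fm n
  ⊥̇          : Fm n
  _∧̇_ _∨̇_ _⇒_ : Fm n → Fm n → Fm n
  ∀̇ ∃̇        : Fm (suc n) → Fm n

-- Renaming (= substitution, since terms are variables).
ext : ∀ {n m} → (Fin n → Fin m) → Fin (suc n) → Fin (suc m)
ext ρ zero    = zero
ext ρ (suc i) = suc (ρ i)

ren : ∀ {n m} → (Fin n → Fin m) → Fm n → Fm m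
ren ρ (x ∈̇ y) = ρ x ∈̇ ρ y
ren ρ (x ≐ y) = ρ x ≐ ρ y
ren ρ ⊥̇       = ⊥̇
ren ρ (φ ∧̇ ψ) = ren ρ φ ∧̇ ren ρ ψ
ren ρ (φ ∨̇ ψ) = ren ρ φ ∨̇ ren ρ ψ
ren ρ (φ ⇒ ψ) = ren ρ φ ⇒ ren ρ ψ
ren ρ (∀̇ φ)   = ∀̇ (ren (ext ρ) φ)
ren ρ (∃̇ φ)   = ∃̇ (ren (ext ρ) φ)

wk : ∀ {n} → Fm n → Fm (suc n)
wk = ren suc

sub₀ : ∀ {n} → Fin n → Fin (suc n) → Fin n
sub₀ t zero    = t
sub₀ t (suc i) = i

_[_] : ∀ {n} → Fm (suc n) → Fin n → Fm n
φ [ t ] = ren (sub₀ t) φ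

¬̇_ : ∀ {n} → Fm n → Fm n
¬̇ φ = φ ⇒ ⊥̇

_⇔_ : ∀ {n} → Fm n → Fm n → Fm n
φ ⇔ ψ = (φ ⇒ ψ) ∧̇ (ψ ⇒ φ)

infix 2 _⊢_
data _⊢_ {n : ℕ} (Γ : List (Fm n)) : Fm n → Set where
  hyp   : ∀ {φ} → φ ∈ Γ → Γ ⊢ φ
  ⊥E    : ∀ {φ} → Γ ⊢ ⊥̇ → Γ ⊢ φ
  ∧I    : ∀ {φ ψ} → Γ ⊢ φ → Γ ⊢ ψ → Γ ⊢ φ ∧̇ ψ
  ∧E₁   : ∀ {φ ψ} → Γ ⊢ φ ∧̇ ψ → Γ ⊢ φ
  ∧E₂   : ∀ {φ ψ} → Γ ⊢ φ ∧̇ ψ → Γ ⊢ ψ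
  ∨I₁   : ∀ {φ ψ} → Γ ⊢ φ → Γ ⊢ φ ∨̇ ψ
  ∨I₂   : ∀ {φ ψ} → Γ ⊢ ψ → Γ ⊢ φ ∨̇ ψ
  ∨E    : ∀ {φ ψ χ} → Γ ⊢ φ ∨̇ ψ → φ ∷ Γ ⊢ χ → ψ ∷ Γ ⊢ χ → Γ ⊢ χ
  ⇒I    : ∀ {φ ψ} → φ ∷ Γ ⊢ ψ → Γ ⊢ φ ⇒ ψ
  ⇒E    : ∀ {φ ψ} → Γ ⊢ φ ⇒ ψ → Γ ⊢ φ → Γ ⊢ ψ
  ∀I    : ∀ {φ} → map wk Γ ⊢ φ → Γ ⊢ ∀̇ φ
  ∀E    : ∀ {φ} → Γ ⊢ ∀̇ φ → (t : Fin n) → Γ ⊢ φ [ t ]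
  ∃I    : ∀ {φ} → (t : Fin n) → Γ ⊢ φ [ t ] → Γ ⊢ ∃̇ φ
  ∃E    : ∀ {φ ψ} → Γ ⊢ ∃̇ φ → φ ∷ map wk Γ ⊢ wk ψ → Γ ⊢ ψ
  ≐refl : (t : Fin n) → Γ ⊢ t ≐ t
  ≐subst : ∀ {φ s t} → Γ ⊢ s ≐ t → Γ ⊢ φ [ s ] → Γ ⊢ φ [ t ]

v0 : ∀ {n} → Fin (suc n)
v0 = zero
v1 : ∀ {n} → Fin (suc (suc n))
v1 = suc zero
v2 : ∀ {n} → Fin (suc (suc (suc n)))
v2 = suc (suc zero)

_⊆̇_ : ∀ {n} → Fin n → Fin n → Fm n
x ⊆̇ y = ∀̇ (v0 ∈̇ suc x ⇒ v0 ∈̇ suc y)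

Trans : ∀ {n} → Fin n → Fm n
Trans x = ∀̇ (v0 ∈̇ suc x ⇒ v0 ⊆̇ suc x)

IsEmpty : ∀ {n} → Fin n → Fm n
IsEmpty x = ∀̇ (¬̇ (v0 ∈̇ suc x))

IsSucc : ∀ {n} → Fin n → Fm n
IsSucc α = ∃̇ (∀̇ (v0 ∈̇ suc (suc α) ⇔ (v0 ∈̇ v1 ∨̇ v0 ≐ v1)))

IsOrd : ∀ {n} → Fin n → Fm n
IsOrd α = Trans α ∧̇ ∀̇ (v0 ∈̇ suc α ⇒ Trans v0)

Inω : ∀ {n} → Fin n → Fm n
Inω α = IsOrd α ∧̇ ∀̇ ((v0 ∈̇ suc α ∨̇ v0 ≐ suc α) ⇒ (IsEmpty v0 ∨̇ IsSucc v0))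

IsSing : ∀ {n} → Fin n → Fin n → Fm n
IsSing z a = ∀̇ (v0 ∈̇ suc z ⇔ v0 ≐ suc a)

IsUPair : ∀ {n} → Fin n → Fin n → Fin n → Fm n
IsUPair z a b = ∀̇ (v0 ∈̇ suc z ⇔ (v0 ≐ suc a ∨̇ v0 ≐ suc b))

IsOPair : ∀ {n} → Fin n → Fin n → Fin n → Fm n
IsOPair p a b = ∀̇ (v0 ∈̇ suc p ⇔ (IsSing v0 (suc a) ∨̇ IsUPair v0 (suc a) (suc b)))

PairIn : ∀ {n} → Fin n → Fin n → Fin n → Fm n
PairIn a b f = ∃̇ (v0 ∈̇ suc f ∧̇ IsOPair v0 (suc a) (suc b))

IsBij : ∀ {n} → Fin n → Fin n → Fin n → Fm n
IsBij f x y =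
  -- every element of f is a pair ⟨a,b⟩ with a ∈ x, b ∈ y
  ∀̇ (v0 ∈̇ suc f ⇒ ∃̇ (v0 ∈̇ suc (suc x) ∧̇ ∃̇ (v0 ∈̇ suc (suc (suc y)) ∧̇ IsOPair v2 v1 v0)))
  -- total
  ∧̇ ∀̇ (v0 ∈̇ suc x ⇒ ∃̇ (v0 ∈̇ suc (suc y) ∧̇ PairIn v1 v0 (suc (suc f))))
  -- functional
  ∧̇ ∀̇ (∀̇ (∀̇ ((PairIn v2 v1 (suc (suc (suc f))) ∧̇ PairIn v2 v0 (suc (suc (suc f)))) ⇒ v1 ≐ v0)))
  -- surjective
  ∧̇ ∀̇ (v0 ∈̇ suc y ⇒ ∃̇ (v0 ∈̇ suc (suc x) ∧̇ PairIn v0 v1 (suc (suc f))))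
  -- injective
  ∧̇ ∀̇ (∀̇ (∀̇ ((PairIn v2 v0 (suc (suc (suc f))) ∧̇ PairIn v1 v0 (suc (suc (suc f)))) ⇒ v2 ≐ v1)))

close : ∀ n → Fm n → Fm 0
close zero    φ = φ
close (suc n) φ = close n (∀̇ φ)

Ind : ∀ {n} → Fm (suc n) → Fm n
Ind φ = ∀̇ (∀̇ (v0 ∈̇ v1 ⇒ ren (ext suc) φ) ⇒ φ) ⇒ ∀̇ φ

data TAx : Fm 0 → Set where
  extensionality : TAx (∀̇ (∀̇ (∀̇ (v0 ∈̇ v2 ⇔ v0 ∈̇ v1) ⇒ v1 ≐ v0)))
  pairing        : TAx (∀̇ (∀̇ (∃̇ (IsUPair v0 v2 v1))))
  union          : TAx (∀̇ (∃̇ (∀̇ (v0 ∈̇ v1 ⇔ ∃̇ (v0 ∈̇ suc v2 ∧̇ v1 ∈̇ v0)))))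
  intersection   : TAx (∀̇ (∀̇ (∃̇ (∀̇ (v0 ∈̇ v1 ⇔ (v0 ∈̇ suc v2 ∧̇ v0 ∈̇ suc v1))))))
  setInduction   : ∀ n (φ : Fm (suc n)) → TAx (close n (Ind φ))
  vEqFin         : TAx (∀̇ (∃̇ (Inω v0 ∧̇ ∃̇ (IsBij v0 v2 v1))))

𝕋⊢_ : Fm 0 → Set
𝕋⊢ φ = Σ (List (Fm 0)) λ Γ → All TAx Γ × (Γ ⊢ φ)

IsTC : ∀ {n} → Fin n → Fin n → Fm n
IsTC x y = Trans y ∧̇ x ⊆̇ y ∧̇ ∀̇ ((Trans v0 ∧̇ suc x ⊆̇ v0) ⇒ suc y ⊆̇ v0)

{-# OPTIONS --safe #-}
module Submission where

open import Defs
open import Data.Nat using (ℕ; suc)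
open import Data.Fin using (Fin; zero; suc)
open import Data.List using (List; []; _∷_; map)
open import Data.List.Membership.Propositional.Properties using (∈-map⁺)
open import Data.List.Relation.Binary.Subset.Propositional using (_⊆_)
open import Data.List.Relation.Binary.Subset.Propositional.Properties using (map⁺; ∷⁺ʳ; xs⊆x∷xs)
open import Data.List.Relation.Unary.Any using (here; there)
open import Data.List.Relation.Unary.All using (All; []; _∷_)
open import Data.Product using (Σ; _×_; _,_)
open import Relation.Binary.PropositionalEquality
  using (_≡_; refl; cong; cong₂; sym; trans; subst; subst₂)

-- Without Replacement the usual ⋃ₙ ⋃ⁿ x is not available; finiteness replaces it.
-- By outer ∈-induction on x, each a ∈ x has a transitive closure t_a.  By V = Fin, fix
-- a bijection f : x → α with α ∈ ω and run an inner ∈-induction over the stages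
-- k ∈ α ∪ {α}: there is a transitive u containing every b ∈ x with f(b) ∈ k and lying
-- inside every transitive superset of x.  Stage ∅ is ∅ itself; at a successor
-- k = γ ∪ {γ}, with f(a) = γ, the set u ∪ t_a ∪ {a} works.  Stage α is TC(x).
-- Extensionality makes TC(x) unique, so IsTC itself defines x ↦ TC(x).

-- Admissibility of weakening and renaming

ext-cong : ∀ {n m} {ρ σ : Fin n → Fin m} → (∀ i → ρ i ≡ σ i) → ∀ i → ext ρ i ≡ ext σ i
ext-cong h zero    = refl
ext-cong h (suc i) = cong suc (h i)

ren-cong : ∀ {n m} {ρ σ : Fin n → Fin m} → (∀ i → ρ i ≡ σ i) → ∀ φ → ren ρ φ ≡ ren σ φ
ren-cong h (x ∈̇ y) = cong₂ _∈̇_ (h x) (h y)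
ren-cong h (x ≐ y) = cong₂ _≐_ (h x) (h y)
ren-cong h ⊥̇       = refl
ren-cong h (φ ∧̇ ψ) = cong₂ _∧̇_ (ren-cong h φ) (ren-cong h ψ)
ren-cong h (φ ∨̇ ψ) = cong₂ _∨̇_ (ren-cong h φ) (ren-cong h ψ)
ren-cong h (φ ⇒ ψ) = cong₂ _⇒_ (ren-cong h φ) (ren-cong h ψ)
ren-cong h (∀̇ φ)   = cong ∀̇ (ren-cong (ext-cong h) φ)
ren-cong h (∃̇ φ)   = cong ∃̇ (ren-cong (ext-cong h) φ)

ext-∘ : ∀ {n m k} (ρ : Fin m → Fin k) (σ : Fin n → Fin m) →
        ∀ i → ext ρ (ext σ i) ≡ ext (λ j → ρ (σ j)) i
ext-∘ ρ σ zero    = refl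
ext-∘ ρ σ (suc i) = refl

ren-∘ : ∀ {n m k} (ρ : Fin m → Fin k) (σ : Fin n → Fin m) φ →
        ren ρ (ren σ φ) ≡ ren (λ i → ρ (σ i)) φ
ren-∘ ρ σ (x ∈̇ y) = refl
ren-∘ ρ σ (x ≐ y) = refl
ren-∘ ρ σ ⊥̇       = refl
ren-∘ ρ σ (φ ∧̇ ψ) = cong₂ _∧̇_ (ren-∘ ρ σ φ) (ren-∘ ρ σ ψ)
ren-∘ ρ σ (φ ∨̇ ψ) = cong₂ _∨̇_ (ren-∘ ρ σ φ) (ren-∘ ρ σ ψ)
ren-∘ ρ σ (φ ⇒ ψ) = cong₂ _⇒_ (ren-∘ ρ σ φ) (ren-∘ ρ σ ψ)
ren-∘ ρ σ (∀̇ φ)   = cong ∀̇ (trans (ren-∘ (ext ρ) (ext σ) φ) (ren-cong (ext-∘ ρ σ) φ))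
ren-∘ ρ σ (∃̇ φ)   = cong ∃̇ (trans (ren-∘ (ext ρ) (ext σ) φ) (ren-cong (ext-∘ ρ σ) φ))

ren-ext-wk : ∀ {n m} (ρ : Fin n → Fin m) φ → ren (ext ρ) (wk φ) ≡ wk (ren ρ φ)
ren-ext-wk ρ φ = trans (ren-∘ (ext ρ) suc φ) (sym (ren-∘ suc ρ φ))

map-ren-ext-wk : ∀ {n m} (ρ : Fin n → Fin m) Γ →
                 map (ren (ext ρ)) (map wk Γ) ≡ map wk (map (ren ρ) Γ)
map-ren-ext-wk ρ []      = refl
map-ren-ext-wk ρ (φ ∷ Γ) = cong₂ _∷_ (ren-ext-wk ρ φ) (map-ren-ext-wk ρ Γ)

ren-[] : ∀ {n m} (ρ : Fin n → Fin m) t φ → ren ρ (φ [ t ]) ≡ ren (ext ρ) φ [ ρ t ]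
ren-[] ρ t φ = trans (ren-∘ ρ (sub₀ t) φ)
                     (trans (ren-cong commute φ) (sym (ren-∘ (sub₀ (ρ t)) (ext ρ) φ)))
  where
  commute : ∀ i → ρ (sub₀ t i) ≡ sub₀ (ρ t) (ext ρ i)
  commute zero    = refl
  commute (suc i) = refl

weaken : ∀ {n} {Γ Δ : List (Fm n)} {φ} → Γ ⊆ Δ → Γ ⊢ φ → Δ ⊢ φ
weaken Γ⊆Δ (hyp φ∈Γ)     = hyp (Γ⊆Δ φ∈Γ)
weaken Γ⊆Δ (⊥E p)        = ⊥E (weaken Γ⊆Δ p)
weaken Γ⊆Δ (∧I p q)      = ∧I (weaken Γ⊆Δ p) (weaken Γ⊆Δ q)
weaken Γ⊆Δ (∧E₁ p)       = ∧E₁ (weaken Γ⊆Δ p)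
weaken Γ⊆Δ (∧E₂ p)       = ∧E₂ (weaken Γ⊆Δ p)
weaken Γ⊆Δ (∨I₁ p)       = ∨I₁ (weaken Γ⊆Δ p)
weaken Γ⊆Δ (∨I₂ p)       = ∨I₂ (weaken Γ⊆Δ p)
weaken Γ⊆Δ (∨E p q r)    = ∨E (weaken Γ⊆Δ p) (weaken (∷⁺ʳ _ Γ⊆Δ) q) (weaken (∷⁺ʳ _ Γ⊆Δ) r)
weaken Γ⊆Δ (⇒I p)        = ⇒I (weaken (∷⁺ʳ _ Γ⊆Δ) p)
weaken Γ⊆Δ (⇒E p q)      = ⇒E (weaken Γ⊆Δ p) (weaken Γ⊆Δ q)
weaken Γ⊆Δ (∀I p)        = ∀I (weaken (map⁺ wk Γ⊆Δ) p)
weaken Γ⊆Δ (∀E p t)      = ∀E (weaken Γ⊆Δ p) t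
weaken Γ⊆Δ (∃I t p)      = ∃I t (weaken Γ⊆Δ p)
weaken Γ⊆Δ (∃E p q)      = ∃E (weaken Γ⊆Δ p) (weaken (∷⁺ʳ _ (map⁺ wk Γ⊆Δ)) q)
weaken Γ⊆Δ (≐refl t)     = ≐refl t
weaken Γ⊆Δ (≐subst p q)  = ≐subst (weaken Γ⊆Δ p) (weaken Γ⊆Δ q)

rename : ∀ {n m} {Γ : List (Fm n)} {φ} (ρ : Fin n → Fin m) → Γ ⊢ φ → map (ren ρ) Γ ⊢ ren ρ φ
rename ρ (hyp φ∈Γ)  = hyp (∈-map⁺ (ren ρ) φ∈Γ)
rename ρ (⊥E p)     = ⊥E (rename ρ p)
rename ρ (∧I p q)   = ∧I (rename ρ p) (rename ρ q)
rename ρ (∧E₁ p)    = ∧E₁ (rename ρ p)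
rename ρ (∧E₂ p)    = ∧E₂ (rename ρ p)
rename ρ (∨I₁ p)    = ∨I₁ (rename ρ p)
rename ρ (∨I₂ p)    = ∨I₂ (rename ρ p)
rename ρ (∨E p q r) = ∨E (rename ρ p) (rename ρ q) (rename ρ r)
rename ρ (⇒I p)     = ⇒I (rename ρ p)
rename ρ (⇒E p q)   = ⇒E (rename ρ p) (rename ρ q)
rename {Γ = Γ} ρ (∀I p) = ∀I (subst (_⊢ _) (map-ren-ext-wk ρ Γ) (rename (ext ρ) p))
rename ρ (∀E {φ = φ} p t) = subst (_ ⊢_) (sym (ren-[] ρ t φ)) (∀E (rename ρ p) (ρ t))
rename ρ (∃I {φ = φ} t p) = ∃I (ρ t) (subst (_ ⊢_) (ren-[] ρ t φ) (rename ρ p))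
rename {Γ = Γ} ρ (∃E {φ = φ} {ψ = ψ} p q) =
  ∃E (rename ρ p)
     (subst₂ (λ Δ χ → ren (ext ρ) φ ∷ Δ ⊢ χ) (map-ren-ext-wk ρ Γ) (ren-ext-wk ρ ψ)
             (rename (ext ρ) q))
rename ρ (≐refl t) = ≐refl (ρ t)
rename ρ (≐subst {φ = φ} {s} {t} p q) =
  subst (_ ⊢_) (sym (ren-[] ρ t φ)) (≐subst (rename ρ p) (subst (_ ⊢_) (ren-[] ρ s φ) (rename ρ q)))

variable
  n : ℕ
  Γ : List (Fm n)
  φ ψ χ : Fm n
  a b c k t u w x y z α γ f : Fin n

↑ : Γ ⊢ φ → map wk Γ ⊢ wk φ
↑ = rename suc

⇑ : Γ ⊢ φ → ψ ∷ Γ ⊢ φ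
⇑ = weaken (xs⊆x∷xs _ _)

⇡ : Γ ⊢ φ → ψ ∷ map wk Γ ⊢ wk φ
⇡ p = ⇑ (↑ p)

hyp₀ : φ ∷ Γ ⊢ φ
hyp₀ = hyp (here refl)

hyp₁ : ψ ∷ φ ∷ Γ ⊢ φ
hyp₁ = hyp (there (here refl))

hyp₂ : χ ∷ ψ ∷ φ ∷ Γ ⊢ φ
hyp₂ = hyp (there (there (here refl)))

⇔I : φ ∷ Γ ⊢ ψ → ψ ∷ Γ ⊢ φ → Γ ⊢ φ ⇔ ψ
⇔I p q = ∧I (⇒I p) (⇒I q)

⇔E₁ : Γ ⊢ φ ⇔ ψ → Γ ⊢ φ → Γ ⊢ ψ
⇔E₁ p = ⇒E (∧E₁ p)

⇔E₂ : Γ ⊢ φ ⇔ ψ → Γ ⊢ ψ → Γ ⊢ φ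
⇔E₂ p = ⇒E (∧E₂ p)

≐sym : Γ ⊢ a ≐ b → Γ ⊢ b ≐ a
≐sym {a = a} p = ≐subst {φ = v0 ≐ suc a} p (≐refl a)

∈-substˡ : Γ ⊢ a ≐ b → Γ ⊢ a ∈̇ c → Γ ⊢ b ∈̇ c
∈-substˡ {c = c} = ≐subst {φ = v0 ∈̇ suc c}

∈-substʳ : Γ ⊢ a ≐ b → Γ ⊢ c ∈̇ a → Γ ⊢ c ∈̇ b
∈-substʳ {c = c} = ≐subst {φ = suc c ∈̇ v0}

⊆̇I : v0 ∈̇ suc x ∷ map wk Γ ⊢ v0 ∈̇ suc y → Γ ⊢ x ⊆̇ y
⊆̇I p = ∀I (⇒I p)

⊆̇E : Γ ⊢ x ⊆̇ y → Γ ⊢ a ∈̇ x → Γ ⊢ a ∈̇ y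
⊆̇E {a = a} p = ⇒E (∀E p a)

⊆̇-trans : Γ ⊢ x ⊆̇ y → Γ ⊢ y ⊆̇ z → Γ ⊢ x ⊆̇ z
⊆̇-trans p q = ⊆̇I (⊆̇E (⇡ q) (⊆̇E (⇡ p) hyp₀))

Trans-E : Γ ⊢ Trans x → Γ ⊢ a ∈̇ x → Γ ⊢ a ⊆̇ x
Trans-E {a = a} p = ⇒E (∀E p a)

Bij-total : Γ ⊢ IsBij f x y → Γ ⊢ a ∈̇ x → Γ ⊢ ∃̇ (v0 ∈̇ suc y ∧̇ PairIn (suc a) v0 (suc f))
Bij-total {a = a} p = ⇒E (∀E (∧E₁ (∧E₂ p)) a)

Bij-onto : Γ ⊢ IsBij f x y → Γ ⊢ a ∈̇ y → Γ ⊢ ∃̇ (v0 ∈̇ suc x ∧̇ PairIn v0 (suc a) (suc f))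
Bij-onto {a = a} p = ⇒E (∀E (∧E₁ (∧E₂ (∧E₂ (∧E₂ p)))) a)

Bij-injective : Γ ⊢ IsBij f x y → Γ ⊢ PairIn a c f → Γ ⊢ PairIn b c f → Γ ⊢ a ≐ b
Bij-injective {a = a} {c = c} {b = b} p pa pb =
  ⇒E (∀E (∀E (∀E (∧E₂ (∧E₂ (∧E₂ (∧E₂ p)))) a) b) c) (∧I pa pb)

IsUnion : Fin n → Fin n → Fm n
IsUnion c w = ∀̇ (v0 ∈̇ suc w ⇔ ∃̇ (v0 ∈̇ suc (suc c) ∧̇ v1 ∈̇ v0))

IsUnion₂ : Fin n → Fin n → Fin n → Fm n
IsUnion₂ a b w = ∀̇ (v0 ∈̇ suc w ⇔ (v0 ∈̇ suc a ∨̇ v0 ∈̇ suc b))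

IsUnionAdjoin : Fin n → Fin n → Fin n → Fin n → Fm n
IsUnionAdjoin u t a w = ∀̇ (v0 ∈̇ suc w ⇔ ((v0 ∈̇ suc u ∨̇ v0 ∈̇ suc t) ∨̇ v0 ≐ suc a))

BelowTransSupersets : Fin n → Fin n → Fm n
BelowTransSupersets x u = ∀̇ ((Trans v0 ∧̇ suc x ⊆̇ v0) ⇒ suc u ⊆̇ v0)

PreimageWithin : Fin n → Fin n → Fin n → Fin n → Fm n
PreimageWithin x f k u =
  ∀̇ (v0 ∈̇ suc x ⇒ ∀̇ (PairIn v1 v0 (suc (suc f)) ⇒ v0 ∈̇ suc (suc k) ⇒ v1 ∈̇ suc (suc u)))

PartialTC : Fin n → Fin n → Fin n → Fin n → Fm n
PartialTC x f k u = Trans u ∧̇ PreimageWithin x f k u ∧̇ BelowTransSupersets x u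

Stage : Fin n → Fin n → Fin n → Fin n → Fm n
Stage x α f k = (k ∈̇ α ∨̇ k ≐ α) ⇒ ∃̇ (PartialTC (suc x) (suc f) (suc k) v0)

Extensionality Pairing Union VEqFin IndTC IndStage : Fm n
Extensionality = ∀̇ (∀̇ (∀̇ (v0 ∈̇ v2 ⇔ v0 ∈̇ v1) ⇒ v1 ≐ v0))
Pairing        = ∀̇ (∀̇ (∃̇ (IsUPair v0 v2 v1)))
Union          = ∀̇ (∃̇ (IsUnion v1 v0))
VEqFin         = ∀̇ (∃̇ (Inω v0 ∧̇ ∃̇ (IsBij v0 v2 v1)))
IndTC          = Ind (∃̇ (IsTC v1 v0))
IndStage       = ∀̇ (∀̇ (∀̇ (Ind (Stage (suc v2) (suc v1) (suc v0) v0))))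

record Axioms (Γ : List (Fm n)) : Set where
  field
    ⊢ext       : Γ ⊢ Extensionality
    ⊢pair      : Γ ⊢ Pairing
    ⊢union     : Γ ⊢ Union
    ⊢fin       : Γ ⊢ VEqFin
    ⊢ind-TC    : Γ ⊢ IndTC
    ⊢ind-Stage : Γ ⊢ IndStage
open Axioms

Axioms-↑ : Axioms Γ → Axioms (map wk Γ)
Axioms-↑ A = record
  { ⊢ext = ↑ (⊢ext A) ; ⊢pair = ↑ (⊢pair A) ; ⊢union = ↑ (⊢union A) ; ⊢fin = ↑ (⊢fin A)
  ; ⊢ind-TC = ↑ (⊢ind-TC A) ; ⊢ind-Stage = ↑ (⊢ind-Stage A) }

Axioms-⇑ : Axioms Γ → Axioms (φ ∷ Γ)
Axioms-⇑ A = record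
  { ⊢ext = ⇑ (⊢ext A) ; ⊢pair = ⇑ (⊢pair A) ; ⊢union = ⇑ (⊢union A) ; ⊢fin = ⇑ (⊢fin A)
  ; ⊢ind-TC = ⇑ (⊢ind-TC A) ; ⊢ind-Stage = ⇑ (⊢ind-Stage A) }

Axioms-⇡ : Axioms Γ → Axioms (φ ∷ map wk Γ)
Axioms-⇡ A = Axioms-⇑ (Axioms-↑ A)

⊆̇-antisym : Axioms Γ → Γ ⊢ a ⊆̇ b → Γ ⊢ b ⊆̇ a → Γ ⊢ a ≐ b
⊆̇-antisym {a = a} {b = b} A p q =
  ⇒E (∀E (∀E (⊢ext A) a) b) (∀I (⇔I (⊆̇E (⇡ p) hyp₀) (⊆̇E (⇡ q) hyp₀)))

-- Unions

∈-union-pair⁻ : Γ ⊢ IsUPair c a b → Γ ⊢ IsUnion c w → Γ ⊢ z ∈̇ w → Γ ⊢ z ∈̇ a ∨̇ z ∈̇ b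
∈-union-pair⁻ {z = z} c≡ab w≡⋃c z∈w =
  ∃E (⇔E₁ (∀E w≡⋃c z) z∈w)
     (∨E (⇔E₁ (∀E (⇡ c≡ab) v0) (∧E₁ hyp₀))
         (∨I₁ (∈-substʳ hyp₀ (∧E₂ hyp₁)))
         (∨I₂ (∈-substʳ hyp₀ (∧E₂ hyp₁))))

∈-union-pair⁺ : Γ ⊢ IsUPair c a b → Γ ⊢ IsUnion c w → Γ ⊢ z ∈̇ a ∨̇ z ∈̇ b → Γ ⊢ z ∈̇ w
∈-union-pair⁺ {a = a} {b = b} {z = z} c≡ab w≡⋃c z∈a∪b =
  ∨E z∈a∪b (⇔E₂ (∀E (⇑ w≡⋃c) z) (∃I a (∧I (⇔E₂ (∀E (⇑ c≡ab) a) (∨I₁ (≐refl a))) hyp₀)))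
           (⇔E₂ (∀E (⇑ w≡⋃c) z) (∃I b (∧I (⇔E₂ (∀E (⇑ c≡ab) b) (∨I₂ (≐refl b))) hyp₀)))

union-pair : Γ ⊢ IsUPair c a b → Γ ⊢ IsUnion c w → Γ ⊢ IsUnion₂ a b w
union-pair c≡ab w≡⋃c =
  ∀I (⇔I (∈-union-pair⁻ (⇡ c≡ab) (⇡ w≡⋃c) hyp₀) (∈-union-pair⁺ (⇡ c≡ab) (⇡ w≡⋃c) hyp₀))

∃-union₂ : Axioms Γ → (a b : Fin n) → Γ ⊢ ∃̇ (IsUnion₂ (suc a) (suc b) v0)
∃-union₂ A a b =
  ∃E (∀E (∀E (⊢pair A) a) b)
     (∃E (∀E (⊢union (Axioms-⇡ A)) v0) (∃I v0 (union-pair (⇑ hyp₀) hyp₀)))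

union-adjoin : Γ ⊢ IsUnion₂ u t c → Γ ⊢ IsUPair y a a → Γ ⊢ IsUnion₂ c y w →
               Γ ⊢ IsUnionAdjoin u t a w
union-adjoin c≡u∪t y≡[a] w≡c∪y = ∀I (⇔I
  (∨E (⇔E₁ (∀E (⇡ w≡c∪y) v0) hyp₀)
      (∨I₁ (⇔E₁ (∀E (⇑ (⇡ c≡u∪t)) v0) hyp₀))
      (∨E (⇔E₁ (∀E (⇑ (⇡ y≡[a])) v0) hyp₀) (∨I₂ hyp₀) (∨I₂ hyp₀)))
  (∨E hyp₀
      (⇔E₂ (∀E (⇑ (⇡ w≡c∪y)) v0) (∨I₁ (⇔E₂ (∀E (⇑ (⇡ c≡u∪t)) v0) hyp₀)))
      (⇔E₂ (∀E (⇑ (⇡ w≡c∪y)) v0) (∨I₂ (⇔E₂ (∀E (⇑ (⇡ y≡[a])) v0) (∨I₁ hyp₀))))))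

∃-union-adjoin : Axioms Γ → (u t a : Fin n) → Γ ⊢ ∃̇ (IsUnionAdjoin (suc u) (suc t) (suc a) v0)
∃-union-adjoin A u t a =
  ∃E (∃-union₂ A u t)
     (∃E (∀E (∀E (⊢pair (Axioms-⇡ A)) (suc a)) (suc a))
         (∃E (∃-union₂ (Axioms-⇡ (Axioms-⇡ A)) v1 v0)
             (∃I v0 (union-adjoin (⇑ (⇑ hyp₀)) (⇑ hyp₀) hyp₀))))

∈-union-adjoin⁻ : Γ ⊢ IsUnionAdjoin u t a w → Γ ⊢ z ∈̇ w → Γ ⊢ (z ∈̇ u ∨̇ z ∈̇ t) ∨̇ z ≐ a
∈-union-adjoin⁻ {z = z} p = ⇔E₁ (∀E p z)

⊆-union-adjoinˡ : Γ ⊢ IsUnionAdjoin u t a w → Γ ⊢ u ⊆̇ w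
⊆-union-adjoinˡ p = ⊆̇I (⇔E₂ (∀E (⇡ p) v0) (∨I₁ (∨I₁ hyp₀)))

⊆-union-adjoinᵐ : Γ ⊢ IsUnionAdjoin u t a w → Γ ⊢ t ⊆̇ w
⊆-union-adjoinᵐ p = ⊆̇I (⇔E₂ (∀E (⇡ p) v0) (∨I₁ (∨I₂ hyp₀)))

∈-union-adjoinʳ : Γ ⊢ IsUnionAdjoin u t a w → Γ ⊢ a ∈̇ w
∈-union-adjoinʳ {a = a} p = ⇔E₂ (∀E p a) (∨I₂ (≐refl a))

-- Transitive closures, stage by stage

IsSuccOf : Fin n → Fin n → Fm n
IsSuccOf k γ = ∀̇ (v0 ∈̇ suc k ⇔ (v0 ∈̇ suc γ ∨̇ v0 ≐ suc γ))

TransI : v0 ∈̇ suc x ∷ map wk Γ ⊢ v0 ⊆̇ suc x → Γ ⊢ Trans x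
TransI p = ∀I (⇒I p)

Below-I : Trans v0 ∧̇ suc x ⊆̇ v0 ∷ map wk Γ ⊢ suc u ⊆̇ v0 → Γ ⊢ BelowTransSupersets x u
Below-I p = ∀I (⇒I p)

Below-E : Γ ⊢ BelowTransSupersets x u → Γ ⊢ Trans z → Γ ⊢ x ⊆̇ z → Γ ⊢ u ⊆̇ z
Below-E {z = z} p Tz x⊆z = ⇒E (∀E p z) (∧I Tz x⊆z)

TC-Trans : Γ ⊢ IsTC a t → Γ ⊢ Trans t
TC-Trans = ∧E₁

TC-⊇ : Γ ⊢ IsTC a t → Γ ⊢ a ⊆̇ t
TC-⊇ p = ∧E₁ (∧E₂ p)

TC-Below : Γ ⊢ IsTC a t → Γ ⊢ BelowTransSupersets a t
TC-Below p = ∧E₂ (∧E₂ p)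

Partial-Trans : Γ ⊢ PartialTC x f k u → Γ ⊢ Trans u
Partial-Trans = ∧E₁

Partial-preimage : Γ ⊢ PartialTC x f k u → Γ ⊢ b ∈̇ x → Γ ⊢ PairIn b c f → Γ ⊢ c ∈̇ k → Γ ⊢ b ∈̇ u
Partial-preimage {b = b} {c = c} p b∈x bc∈f c∈k = ⇒E (⇒E (∀E (⇒E (∀E (∧E₁ (∧E₂ p)) b) b∈x) c) bc∈f) c∈k

Partial-Below : Γ ⊢ PartialTC x f k u → Γ ⊢ BelowTransSupersets x u
Partial-Below p = ∧E₂ (∧E₂ p)

union-adjoin-Trans : Γ ⊢ Trans u → Γ ⊢ IsTC a t → Γ ⊢ IsUnionAdjoin u t a w → Γ ⊢ Trans w
union-adjoin-Trans {w = w} Tu a↦t w≡u∪t∪[a] = TransI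
  (∨E (∈-union-adjoin⁻ (⇡ w≡u∪t∪[a]) hyp₀)
      (∨E hyp₀ (⊆̇-trans (Trans-E (⇑ (⇑ (⇡ Tu))) hyp₀) (⊆-union-adjoinˡ (⇑ (⇑ (⇡ w≡u∪t∪[a])))))
               (⊆̇-trans (Trans-E (⇑ (⇑ (⇡ (TC-Trans a↦t)))) hyp₀)
                        (⊆-union-adjoinᵐ (⇑ (⇑ (⇡ w≡u∪t∪[a]))))))
      (≐subst {φ = v0 ⊆̇ suc (suc w)} (≐sym hyp₀)
              (⊆̇-trans (⇑ (⇡ (TC-⊇ a↦t))) (⊆-union-adjoinᵐ (⇑ (⇡ w≡u∪t∪[a]))))))

union-adjoin-preimage : Γ ⊢ IsSuccOf k γ → Γ ⊢ PartialTC x f γ u → Γ ⊢ IsBij f x α →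
                        Γ ⊢ PairIn a γ f → Γ ⊢ IsUnionAdjoin u t a w →
                        Γ ⊢ b ∈̇ x → Γ ⊢ PairIn b c f → Γ ⊢ c ∈̇ k → Γ ⊢ b ∈̇ w
union-adjoin-preimage {f = f} {b = b} {c = c} k≡γ⁺ u-partial bij aγ∈f w≡u∪t∪[a] b∈x bc∈f c∈k =
  ∨E (⇔E₁ (∀E k≡γ⁺ c) c∈k)
     (⊆̇E (⊆-union-adjoinˡ (⇑ w≡u∪t∪[a])) (Partial-preimage (⇑ u-partial) (⇑ b∈x) (⇑ bc∈f) hyp₀))
     (∈-substˡ (Bij-injective (⇑ bij) (⇑ aγ∈f) (≐subst {φ = PairIn (suc b) v0 (suc f)} hyp₀ (⇑ bc∈f)))
               (∈-union-adjoinʳ (⇑ w≡u∪t∪[a])))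

union-adjoin-⊆ : Γ ⊢ BelowTransSupersets x u → Γ ⊢ a ∈̇ x → Γ ⊢ IsTC a t →
                 Γ ⊢ IsUnionAdjoin u t a w → Γ ⊢ Trans z → Γ ⊢ x ⊆̇ z → Γ ⊢ w ⊆̇ z
union-adjoin-⊆ {Γ = Γ} {u = u} {a = a} {t = t} {z = z} u-below a∈x a↦t w≡u∪t∪[a] Tz x⊆z = ⊆̇I
  (∨E (∈-union-adjoin⁻ (⇡ w≡u∪t∪[a]) hyp₀)
      (∨E hyp₀ (⊆̇E (⇑ (⇑ (⇡ u⊆z))) hyp₀) (⊆̇E (⇑ (⇑ (⇡ t⊆z))) hyp₀))
      (∈-substˡ (≐sym hyp₀) (⇑ (⇡ a∈z))))
  where
  u⊆z : Γ ⊢ u ⊆̇ z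
  u⊆z = Below-E u-below Tz x⊆z
  a∈z : Γ ⊢ a ∈̇ z
  a∈z = ⊆̇E x⊆z a∈x
  t⊆z : Γ ⊢ t ⊆̇ z
  t⊆z = Below-E (TC-Below a↦t) Tz (Trans-E Tz a∈z)

partialTC-succ : Γ ⊢ IsSuccOf k γ → Γ ⊢ PartialTC x f γ u → Γ ⊢ IsBij f x α → Γ ⊢ a ∈̇ x →
                 Γ ⊢ PairIn a γ f → Γ ⊢ IsTC a t → Γ ⊢ IsUnionAdjoin u t a w →
                 Γ ⊢ PartialTC x f k w
partialTC-succ k≡γ⁺ u-partial bij a∈x aγ∈f a↦t w≡u∪t∪[a] =
  ∧I (union-adjoin-Trans (Partial-Trans u-partial) a↦t w≡u∪t∪[a])
     (∧I (∀I (⇒I (∀I (⇒I (⇒I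
            (union-adjoin-preimage (⇡⇡ k≡γ⁺) (⇡⇡ u-partial) (⇡⇡ bij) (⇡⇡ aγ∈f) (⇡⇡ w≡u∪t∪[a])
                                   hyp₂ hyp₁ hyp₀))))))
         (Below-I (union-adjoin-⊆ (⇡ (Partial-Below u-partial)) (⇡ a∈x) (⇡ a↦t) (⇡ w≡u∪t∪[a])
                                  (∧E₁ hyp₀) (∧E₂ hyp₀))))
  where
  ⇡⇡ : ∀ {n} {Γ : List (Fm n)} {φ ψ χ θ} → Γ ⊢ φ → χ ∷ θ ∷ map wk (ψ ∷ map wk Γ) ⊢ wk (wk φ)
  ⇡⇡ p = ⇑ (⇡ (⇡ p))

ElementsHaveTC : Fin n → Fm n
ElementsHaveTC x = ∀̇ (v0 ∈̇ suc x ⇒ ∃̇ (IsTC v1 v0))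

StagesBelow : Fin n → Fin n → Fin n → Fin n → Fm n
StagesBelow x α f k = ∀̇ (v0 ∈̇ suc k ⇒ Stage (suc x) (suc α) (suc f) v0)

∃-partialTC-succ : Axioms Γ → Γ ⊢ IsSuccOf k γ → Γ ⊢ k ∈̇ α ∨̇ k ≐ α → Γ ⊢ Inω α →
                   Γ ⊢ IsBij f x α → Γ ⊢ ElementsHaveTC x → Γ ⊢ StagesBelow x α f k →
                   Γ ⊢ ∃̇ (PartialTC (suc x) (suc f) (suc k) v0)
∃-partialTC-succ {Γ = Γ} {k = k} {γ = γ} {α = α} {f = f} {x = x} A k≡γ⁺ k≤α α∈ω bij elements-TC stages =
  ∃E ∃u
     (∃E (⇡ ∃a)
         (∃E (⇒E (∀E (⇡ (⇡ elements-TC)) v0) (∧E₁ hyp₀))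
             (∃E (∃-union-adjoin (Axioms-⇡ (Axioms-⇡ (Axioms-⇡ A))) v2 v0 v1)
                 (∃I v0 (partialTC-succ (⇡ (⇡ (⇡ (⇡ k≡γ⁺)))) (⇡ (⇡ (⇡ hyp₀))) (⇡ (⇡ (⇡ (⇡ bij))))
                                        (⇡ (⇡ (∧E₁ hyp₀))) (⇡ (⇡ (∧E₂ hyp₀))) (⇡ hyp₀) hyp₀)))))
  where
  γ∈k : Γ ⊢ γ ∈̇ k
  γ∈k = ⇔E₂ (∀E k≡γ⁺ γ) (∨I₂ (≐refl γ))
  γ∈α : Γ ⊢ γ ∈̇ α
  γ∈α = ∨E k≤α (⊆̇E (Trans-E (∧E₁ (∧E₁ (⇑ α∈ω))) hyp₀) (⇑ γ∈k)) (∈-substʳ hyp₀ (⇑ γ∈k))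
  ∃u : Γ ⊢ ∃̇ (PartialTC (suc x) (suc f) (suc γ) v0)
  ∃u = ⇒E (⇒E (∀E stages γ) γ∈k) (∨I₁ γ∈α)
  ∃a : Γ ⊢ ∃̇ (v0 ∈̇ suc x ∧̇ PairIn v0 (suc γ) (suc f))
  ∃a = Bij-onto bij γ∈α

partialTC-empty : Γ ⊢ IsEmpty k → Γ ⊢ PartialTC x f k k
partialTC-empty k≡∅ =
  ∧I (TransI (⊥E (⇒E (∀E (⇡ k≡∅) v0) hyp₀)))
     (∧I (∀I (⇒I (∀I (⇒I (⇒I (⊥E (⇒E (∀E (⇑ (⇑ (↑ (⇡ k≡∅)))) v0) hyp₀)))))))
         (Below-I (⊆̇I (⊥E (⇒E (∀E (⇡ (⇡ k≡∅)) v0) hyp₀)))))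

stage-step : Axioms Γ → Γ ⊢ Inω α → Γ ⊢ IsBij f x α → Γ ⊢ ElementsHaveTC x →
             Γ ⊢ StagesBelow x α f k → Γ ⊢ Stage x α f k
stage-step {k = k} A α∈ω bij elements-TC stages = ⇒I
  (∨E (⇒E (∀E (∧E₂ (⇑ α∈ω)) k) hyp₀)
      (∃I k (partialTC-empty hyp₀))
      (∃E hyp₀ (∃-partialTC-succ (Axioms-⇡ (Axioms-⇑ (Axioms-⇑ A))) hyp₀ hyp₂
                                 (⇡ (⇑ (⇑ α∈ω))) (⇡ (⇑ (⇑ bij)))
                                 (⇡ (⇑ (⇑ elements-TC))) (⇡ (⇑ (⇑ stages))))))

partialTC-full⇒TC : Γ ⊢ IsBij f x α → Γ ⊢ PartialTC x f α u → Γ ⊢ IsTC x u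
partialTC-full⇒TC {Γ = Γ} {x = x} {u = u} bij u-partial =
  ∧I (Partial-Trans u-partial) (∧I x⊆u (Partial-Below u-partial))
  where
  x⊆u : Γ ⊢ x ⊆̇ u
  x⊆u = ⊆̇I (∃E (Bij-total (⇡ bij) hyp₀)
                (Partial-preimage (⇡ (⇡ u-partial)) hyp₁ (∧E₂ hyp₀) (∧E₁ hyp₀)))

∃TC-of-finite : Axioms Γ → Γ ⊢ Inω α → Γ ⊢ IsBij f x α → Γ ⊢ ElementsHaveTC x →
                Γ ⊢ ∃̇ (IsTC (suc x) v0)
∃TC-of-finite {Γ = Γ} {α = α} {f = f} {x = x} A α∈ω bij elements-TC =
  ∃E stage-α (∃I v0 (partialTC-full⇒TC (⇡ bij) hyp₀))
  where
  all-stages : Γ ⊢ ∀̇ (Stage (suc x) (suc α) (suc f) v0)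
  all-stages = ⇒E (∀E (∀E (∀E (⊢ind-Stage A) x) α) f)
                  (∀I (⇒I (stage-step (Axioms-⇡ A) (⇡ α∈ω) (⇡ bij) (⇡ elements-TC) hyp₀)))
  stage-α : Γ ⊢ ∃̇ (PartialTC (suc x) (suc f) (suc α) v0)
  stage-α = ⇒E (∀E all-stages α) (∨I₂ (≐refl α))

∃TC-step : Axioms Γ → Γ ⊢ ElementsHaveTC x → Γ ⊢ ∃̇ (IsTC (suc x) v0)
∃TC-step {x = x} A elements-TC =
  ∃E (∀E (⊢fin A) x) (∃E (∧E₂ hyp₀)
     (∃TC-of-finite (Axioms-⇡ (Axioms-⇡ A)) (⇡ (∧E₁ hyp₀)) hyp₀ (⇡ (⇡ elements-TC))))

∃TC : Axioms Γ → Γ ⊢ ∀̇ (∃̇ (IsTC v1 v0))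
∃TC A = ⇒E (⊢ind-TC A) (∀I (⇒I (∃TC-step (Axioms-⇡ A) hyp₀)))

TC-unique : Axioms Γ → Γ ⊢ IsTC x y → Γ ⊢ ∀̇ (IsTC (suc x) v0 ⇒ v0 ≐ suc y)
TC-unique A x↦y = ∀I (⇒I (⊆̇-antisym (Axioms-⇡ A)
  (Below-E (TC-Below hyp₀) (TC-Trans (⇡ x↦y)) (TC-⊇ (⇡ x↦y)))
  (Below-E (TC-Below (⇡ x↦y)) (TC-Trans hyp₀) (TC-⊇ hyp₀))))

∃!TC : Axioms Γ → Γ ⊢ ∀̇ (∃̇ (IsTC v1 v0 ∧̇ ∀̇ (IsTC v2 v0 ⇒ v0 ≐ v1)))
∃!TC A = ∀I (∃E (∀E (∃TC (Axioms-↑ A)) v0) (∃I v0 (∧I hyp₀ (TC-unique (Axioms-⇡ (Axioms-↑ A)) hyp₀))))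

𝕋-fragment : List (Fm 0)
𝕋-fragment = Extensionality ∷ Pairing ∷ Union ∷ VEqFin ∷ IndTC ∷ IndStage ∷ []

𝕋-fragment-axioms : All TAx 𝕋-fragment
𝕋-fragment-axioms = extensionality ∷ pairing ∷ union ∷ vEqFin
                  ∷ setInduction 0 (∃̇ (IsTC v1 v0)) ∷ setInduction 3 (Stage (suc v2) (suc v1) (suc v0) v0) ∷ []

𝕋-fragment-Axioms : Axioms 𝕋-fragment
𝕋-fragment-Axioms = record
  { ⊢ext = hyp₀ ; ⊢pair = ⇑ hyp₀ ; ⊢union = ⇑ hyp₁ ; ⊢fin = ⇑ hyp₂
  ; ⊢ind-TC = ⇑ (⇑ hyp₂) ; ⊢ind-Stage = ⇑ (⇑ (⇑ hyp₂)) }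

mainTheorem11 : (𝕋⊢ ∀̇ (∃̇ (IsTC v1 v0)))
                  × Σ (Fm 2) (λ φ → (𝕋⊢ ∀̇ (∃̇ (φ ∧̇ ∀̇ (ren (ext suc) φ ⇒ v0 ≐ v1))))
                                  × (𝕋⊢ ∀̇ (∀̇ (φ ⇒ IsTC v1 v0))))
mainTheorem11 =
  (𝕋-fragment , 𝕋-fragment-axioms , ∃TC 𝕋-fragment-Axioms)
  , IsTC v1 v0
  , (𝕋-fragment , 𝕋-fragment-axioms , ∃!TC 𝕋-fragment-Axioms)
  , (𝕋-fragment , 𝕋-fragment-axioms , ∀I (∀I (⇒I hyp₀)))
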